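{- For every $n\ge 1$, the domination polynomial $D(F_n,x)$ of the friendship graph $F_n$ has no nonzero integer root.
   Context: For a finite simple graph $G$, the domination polynomial is $D(G,x)=\sum_i d(G,i)x^i$, where $d(G,i)$ is the number of dominating sets of size $i$ (a set $S$ of vertices is dominating if every vertex outside $S$ has a neighbor in $S$). The friendship graph $F_n=K_1+nK_2$ is $n$ triangles glued at a common vertex; its domination polynomial is $D(F_n,x)=(2x+x^2)^n+x(1+x)^{2n}$. -}

module Defs where

open import Data.Nat as ℕ using (ℕ; zero; suc; _/_; _∸_)
open import Data.Fin using (Fin; toℕ)
open import Data.Bool using (Bool; true; false; _∧_; _∨_; not; if_then_else_)
open import Data.Vec as Vec using (Vec; []; _∷_; lookup; allFin)
open import Data.List as List using (List; []; _∷_)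
open import Data.Integer as ℤ using (ℤ; 1ℤ; 0ℤ)
open import Relation.Binary.PropositionalEquality using (_≡_)
open import Relation.Nullary.Decidable using (⌊_⌋)

record Graph (n : ℕ) : Set where
  field
    adj        : Fin n → Fin n → Bool
    adj-sym    : ∀ i j → adj i j ≡ adj j i
    adj-irrefl : ∀ i → adj i i ≡ false
open Graph public

-- A vertex subset is a Boolean vector (true = in S).
Subset : ℕ → Set
Subset n = Vec Bool n

allSubsets : (n : ℕ) → List (Subset n)
allSubsets zero    = [] ∷ []
allSubsets (suc n) = List.map (false ∷_) (allSubsets n) List.++ List.map (true ∷_) (allSubsets n)

size : ∀ {n} → Subset n → ℕ
size []          = 0
size (true ∷ s)  = suc (size s)
size (false ∷ s) = size s

anyFin : ∀ {n} → (Fin n → Bool) → Bool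
anyFin {n} p = Vec.foldr (λ _ → Bool) (λ b r → b ∨ r) false (Vec.map p (allFin n))

allFin? : ∀ {n} → (Fin n → Bool) → Bool
allFin? {n} p = Vec.foldr (λ _ → Bool) (λ b r → b ∧ r) true (Vec.map p (allFin n))

isDominating : ∀ {n} → Graph n → Subset n → Bool
isDominating G S = allFin? (λ v → lookup S v ∨ anyFin (λ u → lookup S u ∧ adj G u v))

dominationPoly : ∀ {n} → Graph n → ℤ → ℤ
dominationPoly {n} G x =
  List.foldr ℤ._+_ 0ℤ
    (List.map (λ S → if isDominating G S then x ℤ.^ size S else 0ℤ) (allSubsets n))

-- Friendship graph F_m = K_1 + m K_2 on vertices Fin (1 + 2m):
-- vertex 0 is the centre; vertices 2i+1 and 2i+2 (i < m) form the i-th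
-- triangle together with the centre.
friendAdj : ∀ {k} → Fin k → Fin k → Bool
friendAdj u v with toℕ u | toℕ v
... | zero  | zero  = false
... | zero  | suc _ = true
... | suc _ | zero  = true
... | suc a | suc b = not ⌊ a ℕ.≟ b ⌋ ∧ ⌊ (a / 2) ℕ.≟ (b / 2) ⌋

open import Relation.Binary.PropositionalEquality using (refl; sym; cong₂)
open import Data.Bool.Properties using (∧-comm)
open import Relation.Nullary using (yes; no)

private
  eqb-sym : ∀ a b → ⌊ a ℕ.≟ b ⌋ ≡ ⌊ b ℕ.≟ a ⌋
  eqb-sym a b with a ℕ.≟ b | b ℕ.≟ a
  ... | yes _ | yes _ = refl
  ... | no _  | no _  = refl
  ... | yes p | no q  with q (sym p)
  ... | ()
  eqb-sym a b | no q | yes p with q (sym p)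
  ... | ()

  eqb-refl : ∀ a → ⌊ a ℕ.≟ a ⌋ ≡ true
  eqb-refl a with a ℕ.≟ a
  ... | yes _ = refl
  ... | no q with q refl
  ... | ()

  fa : ℕ → ℕ → Bool
  fa zero zero = false
  fa zero (suc _) = true
  fa (suc _) zero = true
  fa (suc a) (suc b) = not ⌊ a ℕ.≟ b ⌋ ∧ ⌊ (a / 2) ℕ.≟ (b / 2) ⌋

  fa-sym : ∀ a b → fa a b ≡ fa b a
  fa-sym zero zero = refl
  fa-sym zero (suc _) = refl
  fa-sym (suc _) zero = refl
  fa-sym (suc a) (suc b) = cong₂ (λ p q → not p ∧ q) (eqb-sym a b) (eqb-sym (a / 2) (b / 2))

  fa-irr : ∀ a → fa a a ≡ false
  fa-irr zero = refl
  fa-irr (suc a) rewrite eqb-refl a = refl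

  fa-ok : ∀ {k} (u v : Fin k) → friendAdj u v ≡ fa (toℕ u) (toℕ v)
  fa-ok u v with toℕ u | toℕ v
  ... | zero  | zero  = refl
  ... | zero  | suc _ = refl
  ... | suc _ | zero  = refl
  ... | suc a | suc b = refl

friendship : (m : ℕ) → Graph (suc (2 ℕ.* m))
friendship m = record
  { adj = friendAdj
  ; adj-sym = λ i j → Relation.Binary.PropositionalEquality.trans (fa-ok i j)
      (Relation.Binary.PropositionalEquality.trans (fa-sym (toℕ i) (toℕ j)) (sym (fa-ok j i)))
  ; adj-irrefl = λ i → Relation.Binary.PropositionalEquality.trans (fa-ok i i) (fa-irr (toℕ i))
  }

{-# OPTIONS --safe #-}
-- Sorting the dominating sets of F_n by whether they contain the centre gives
-- D(F_n, x) = (2x + x²)^n + x (1 + x)^(2n): together with the centre every set of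
-- leaves dominates, while without it the set must meet the base edge of every
-- triangle, and 2x + x² = D(K₂, x) counts the nonempty subsets of an edge.
-- For n ≥ 1 this factors as x · q(x) with q(x) = (x + 2)(2x + x²)^(n-1) + (1 + x)^(2n),
-- and q(x) is odd for every integer x (look at x even and x odd separately).
module Submission where

open import Defs
open import Data.Bool using (Bool; true; false; _∧_; _∨_; not; if_then_else_)
open import Data.Bool.Properties using (∨-zeroʳ; ∧-zeroʳ; ∧-identityʳ; ∧-assoc; ∧-idem)
open import Data.Fin using (Fin; toℕ) renaming (zero to fz; suc to fs)
open import Data.Integer using (ℤ; 0ℤ; 1ℤ; +_; -[1+_]; _+_; _*_; _^_)
open import Data.Integer.DivMod using (_%ℕ_; _/ℕ_; n%ℕd<d; a≡a%ℕn+[a/ℕn]*n)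
import Data.Integer.Properties as ℤ
open import Data.Integer.Tactic.RingSolver using (solve-∀)
open import Data.List as List using (List; []; _∷_; _++_)
import Data.List.Properties as List
open import Data.Nat as ℕ using (ℕ; zero; suc; _/_; _≥_; s≤s; z≤n)
open import Data.Nat.DivMod using (m/n≡1+[m∸n]/n)
import Data.Nat.Properties as ℕ
open import Data.Product using (∃-syntax; _,_)
open import Data.Sum using (_⊎_; inj₁; inj₂; [_,_]′)
open import Data.Vec as Vec using (Vec; []; _∷_; lookup)
open import Data.Vec.Properties using (tabulate-allFin; map-cong)
open import Function using (_∘_)
open import Relation.Binary.PropositionalEquality
open import Relation.Nullary using (¬_; yes; no; contradiction)
open import Relation.Nullary.Decidable using (⌊_⌋)

private
  variable
    m n : ℕ

anyFin-suc : (p : Fin (suc n) → Bool) → anyFin p ≡ p fz ∨ anyFin (p ∘ fs)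
anyFin-suc p = trans (cong (Vec.foldr _ _∨_ false) (sym (tabulate-allFin p)))
                     (cong (p fz ∨_) (cong (Vec.foldr _ _∨_ false) (tabulate-allFin (p ∘ fs))))

allFin?-suc : (p : Fin (suc n) → Bool) → allFin? p ≡ p fz ∧ allFin? (p ∘ fs)
allFin?-suc p = trans (cong (Vec.foldr _ _∧_ true) (sym (tabulate-allFin p)))
                      (cong (p fz ∧_) (cong (Vec.foldr _ _∧_ true) (tabulate-allFin (p ∘ fs))))

anyFin-suc₂ : (p : Fin (suc (suc n)) → Bool) → anyFin p ≡ p fz ∨ (p (fs fz) ∨ anyFin (p ∘ fs ∘ fs))
anyFin-suc₂ p = trans (anyFin-suc p) (cong (p fz ∨_) (anyFin-suc (p ∘ fs)))

allFin?-suc₂ : (p : Fin (suc (suc n)) → Bool) → allFin? p ≡ p fz ∧ (p (fs fz) ∧ allFin? (p ∘ fs ∘ fs))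
allFin?-suc₂ p = trans (allFin?-suc p) (cong (p fz ∧_) (allFin?-suc (p ∘ fs)))

anyFin-cong : {p q : Fin n → Bool} → (∀ i → p i ≡ q i) → anyFin p ≡ anyFin q
anyFin-cong {n} p≗q = cong (Vec.foldr _ _∨_ false) (map-cong p≗q (Vec.allFin n))

allFin?-cong : {p q : Fin n → Bool} → (∀ i → p i ≡ q i) → allFin? p ≡ allFin? q
allFin?-cong {n} p≗q = cong (Vec.foldr _ _∧_ true) (map-cong p≗q (Vec.allFin n))

anyFin-∧-false : (p q : Fin n → Bool) → (∀ i → q i ≡ false) → anyFin (λ i → p i ∧ q i) ≡ false
anyFin-∧-false {zero} p q q≡false = refl
anyFin-∧-false {suc n} p q q≡false = begin
  anyFin (λ i → p i ∧ q i)
    ≡⟨ anyFin-suc (λ i → p i ∧ q i) ⟩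
  p fz ∧ q fz ∨ anyFin (λ i → p (fs i) ∧ q (fs i))
    ≡⟨ cong₂ (λ a b → p fz ∧ a ∨ b) (q≡false fz) (anyFin-∧-false (p ∘ fs) (q ∘ fs) (q≡false ∘ fs)) ⟩
  p fz ∧ false ∨ false
    ≡⟨ cong (_∨ false) (∧-zeroʳ (p fz)) ⟩
  false ∎
  where open ≡-Reasoning

allFin?-true : (p : Fin n → Bool) → (∀ i → p i ≡ true) → allFin? p ≡ true
allFin?-true {zero} p p≡true = refl
allFin?-true {suc n} p p≡true =
  trans (allFin?-suc p) (cong₂ _∧_ (p≡true fz) (allFin?-true (p ∘ fs) (p≡true ∘ fs)))

-- friendAdj between the non-central vertices fs i and fs j, reindexed from 0:
-- the base edges of the triangles become {2k, 2k+1}.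
matchingAdj : ℕ → ℕ → Bool
matchingAdj 0 1 = true
matchingAdj 1 0 = true
matchingAdj (suc (suc i)) (suc (suc j)) = matchingAdj i j
matchingAdj _ _ = false

[2+i]/2≡1+[i/2] : ∀ i → suc (suc i) / 2 ≡ suc (i / 2)
[2+i]/2≡1+[i/2] i = m/n≡1+[m∸n]/n {suc (suc i)} (s≤s (s≤s z≤n))

-- Not definitional: the evidence carried by _≟_ blocks ⌊_⌋ on open terms.
⌊suc≟suc⌋ : ∀ a b → ⌊ suc a ℕ.≟ suc b ⌋ ≡ ⌊ a ℕ.≟ b ⌋
⌊suc≟suc⌋ a b with a ℕ.≟ b | suc a ℕ.≟ suc b
... | yes _   | yes _     = refl
... | no _    | no _      = refl
... | yes a≡b | no sa≢sb  = contradiction (cong suc a≡b) sa≢sb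
... | no a≢b  | yes sa≡sb = contradiction (ℕ.suc-injective sa≡sb) a≢b

friendAdj-suc-suc : ∀ {k} (u w : Fin k) → friendAdj (fs u) (fs w) ≡ matchingAdj (toℕ u) (toℕ w)
friendAdj-suc-suc u w = onIndices (toℕ u) (toℕ w)
  where
  onIndices : ∀ i j → not ⌊ i ℕ.≟ j ⌋ ∧ ⌊ i / 2 ℕ.≟ j / 2 ⌋ ≡ matchingAdj i j
  onIndices 0 0 = refl
  onIndices 0 1 = refl
  onIndices 1 0 = refl
  onIndices 1 1 = refl
  onIndices 0 (suc (suc j)) rewrite [2+i]/2≡1+[i/2] j = refl
  onIndices 1 (suc (suc j)) rewrite [2+i]/2≡1+[i/2] j = refl
  onIndices (suc (suc i)) 0 rewrite [2+i]/2≡1+[i/2] i = refl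
  onIndices (suc (suc i)) 1 rewrite [2+i]/2≡1+[i/2] i = refl
  onIndices (suc (suc i)) (suc (suc j)) = begin
    not ⌊ 2 ℕ.+ i ℕ.≟ 2 ℕ.+ j ⌋ ∧ ⌊ (2 ℕ.+ i) / 2 ℕ.≟ (2 ℕ.+ j) / 2 ⌋
      ≡⟨ cong₂ (λ a b → not a ∧ b) (⌊suc≟suc⌋ (suc i) (suc j))
               (cong₂ (λ a b → ⌊ a ℕ.≟ b ⌋) ([2+i]/2≡1+[i/2] i) ([2+i]/2≡1+[i/2] j)) ⟩
    not ⌊ suc i ℕ.≟ suc j ⌋ ∧ ⌊ suc (i / 2) ℕ.≟ suc (j / 2) ⌋
      ≡⟨ cong₂ (λ a b → not a ∧ b) (⌊suc≟suc⌋ i j) (⌊suc≟suc⌋ (i / 2) (j / 2)) ⟩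
    not ⌊ i ℕ.≟ j ⌋ ∧ ⌊ i / 2 ℕ.≟ j / 2 ⌋
      ≡⟨ onIndices i j ⟩
    matchingAdj i j ∎
    where open ≡-Reasoning

-- Any length is allowed, since 2 * n is not syntactically of the form suc (suc _);
-- an unpaired last vertex then has to be in the set itself.
hitsEveryPair : Vec Bool m → Bool
hitsEveryPair []          = true
hitsEveryPair (a ∷ [])    = a
hitsEveryPair (a ∷ c ∷ s) = (a ∨ c) ∧ hitsEveryPair s

dominatedInMatching : Vec Bool m → Fin m → Bool
dominatedInMatching s w = lookup s w ∨ anyFin (λ u → lookup s u ∧ matchingAdj (toℕ u) (toℕ w))

module _ (a c : Bool) (s : Vec Bool m) where
  dominatedInMatching-0 : dominatedInMatching (a ∷ c ∷ s) fz ≡ a ∨ c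
  dominatedInMatching-0 = begin
    dominatedInMatching (a ∷ c ∷ s) fz
      ≡⟨ cong (a ∨_) (anyFin-suc₂ (λ u → lookup (a ∷ c ∷ s) u ∧ matchingAdj (toℕ u) 0)) ⟩
    a ∨ (a ∧ false ∨ (c ∧ true ∨ anyFin (λ u → lookup s u ∧ false)))
      ≡⟨ cong (λ b → a ∨ (a ∧ false ∨ (c ∧ true ∨ b))) (anyFin-∧-false (lookup s) _ (λ _ → refl)) ⟩
    a ∨ (a ∧ false ∨ (c ∧ true ∨ false))
      ≡⟨ tautology a c ⟩
    a ∨ c ∎
    where
    open ≡-Reasoning
    tautology : ∀ a c → a ∨ (a ∧ false ∨ (c ∧ true ∨ false)) ≡ a ∨ c
    tautology true  c = refl
    tautology false true = refl
    tautology false false = refl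

  dominatedInMatching-1 : dominatedInMatching (a ∷ c ∷ s) (fs fz) ≡ a ∨ c
  dominatedInMatching-1 = begin
    dominatedInMatching (a ∷ c ∷ s) (fs fz)
      ≡⟨ cong (c ∨_) (anyFin-suc₂ (λ u → lookup (a ∷ c ∷ s) u ∧ matchingAdj (toℕ u) 1)) ⟩
    c ∨ (a ∧ true ∨ (c ∧ false ∨ anyFin (λ u → lookup s u ∧ false)))
      ≡⟨ cong (λ b → c ∨ (a ∧ true ∨ (c ∧ false ∨ b))) (anyFin-∧-false (lookup s) _ (λ _ → refl)) ⟩
    c ∨ (a ∧ true ∨ (c ∧ false ∨ false))
      ≡⟨ tautology a c ⟩
    a ∨ c ∎
    where
    open ≡-Reasoning
    tautology : ∀ a c → c ∨ (a ∧ true ∨ (c ∧ false ∨ false)) ≡ a ∨ c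
    tautology a true  = sym (∨-zeroʳ a)
    tautology true false = refl
    tautology false false = refl

  dominatedInMatching-suc-suc : ∀ w → dominatedInMatching (a ∷ c ∷ s) (fs (fs w)) ≡ dominatedInMatching s w
  dominatedInMatching-suc-suc w = cong (lookup s w ∨_) (begin
    anyFin (λ u → lookup (a ∷ c ∷ s) u ∧ matchingAdj (toℕ u) (2 ℕ.+ toℕ w))
      ≡⟨ anyFin-suc₂ (λ u → lookup (a ∷ c ∷ s) u ∧ matchingAdj (toℕ u) (2 ℕ.+ toℕ w)) ⟩
    a ∧ false ∨ (c ∧ false ∨ anyFin (λ u → lookup s u ∧ matchingAdj (toℕ u) (toℕ w)))
      ≡⟨ cong₂ (λ x y → x ∨ (y ∨ _)) (∧-zeroʳ a) (∧-zeroʳ c) ⟩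
    anyFin (λ u → lookup s u ∧ matchingAdj (toℕ u) (toℕ w)) ∎)
    where open ≡-Reasoning

allFin?-dominatedInMatching : (s : Vec Bool m) → allFin? (dominatedInMatching s) ≡ hitsEveryPair s
allFin?-dominatedInMatching [] = refl
allFin?-dominatedInMatching (true ∷ []) = refl
allFin?-dominatedInMatching (false ∷ []) = refl
allFin?-dominatedInMatching (a ∷ c ∷ s) = begin
  allFin? d
    ≡⟨ allFin?-suc₂ d ⟩
  d fz ∧ (d (fs fz) ∧ allFin? (d ∘ fs ∘ fs))
    ≡⟨ cong₂ (λ x y → x ∧ (y ∧ allFin? (d ∘ fs ∘ fs))) (dominatedInMatching-0 a c s) (dominatedInMatching-1 a c s) ⟩
  (a ∨ c) ∧ ((a ∨ c) ∧ allFin? (d ∘ fs ∘ fs))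
    ≡⟨ cong (λ z → (a ∨ c) ∧ ((a ∨ c) ∧ z))
            (trans (allFin?-cong (dominatedInMatching-suc-suc a c s)) (allFin?-dominatedInMatching s)) ⟩
  (a ∨ c) ∧ ((a ∨ c) ∧ hitsEveryPair s)
    ≡⟨ trans (sym (∧-assoc (a ∨ c) _ _)) (cong (_∧ hitsEveryPair s) (∧-idem (a ∨ c))) ⟩
  (a ∨ c) ∧ hitsEveryPair s ∎
  where
  open ≡-Reasoning
  d : Fin (2 ℕ.+ _) → Bool
  d = dominatedInMatching (a ∷ c ∷ s)

hitsEveryPair⇒nonempty : (s : Vec Bool (suc m)) → anyFin (lookup s) ∧ hitsEveryPair s ≡ hitsEveryPair s
hitsEveryPair⇒nonempty (true ∷ []) = refl
hitsEveryPair⇒nonempty (false ∷ []) = refl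
hitsEveryPair⇒nonempty (a ∷ c ∷ s) =
  trans (cong (_∧ hitsEveryPair (a ∷ c ∷ s)) (anyFin-suc₂ (lookup (a ∷ c ∷ s)))) (absorb a c)
  where
  absorb : ∀ a c → (a ∨ (c ∨ anyFin (lookup s))) ∧ ((a ∨ c) ∧ hitsEveryPair s) ≡ (a ∨ c) ∧ hitsEveryPair s
  absorb true  c    = refl
  absorb false true = refl
  absorb false false = ∧-zeroʳ (anyFin (lookup s))

dominatedBy : Graph n → Subset n → Fin n → Bool
dominatedBy G S v = lookup S v ∨ anyFin (λ u → lookup S u ∧ adj G u v)

isDominating-friendship-centre : ∀ n (s : Subset (2 ℕ.* n)) → isDominating (friendship n) (true ∷ s) ≡ true
isDominating-friendship-centre n s = allFin?-true _ dominated
  where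
  dominated : ∀ v → dominatedBy (friendship n) (true ∷ s) v ≡ true
  dominated fz     = refl
  dominated (fs w) = trans (cong (lookup s w ∨_) (anyFin-suc (λ u → lookup (true ∷ s) u ∧ friendAdj u (fs w))))
                           (∨-zeroʳ (lookup s w))

isDominating-friendship-noCentre : ∀ n (s : Subset (2 ℕ.* n)) →
  isDominating (friendship n) (false ∷ s) ≡ anyFin (lookup s) ∧ hitsEveryPair s
isDominating-friendship-noCentre n s =
  trans (allFin?-suc (dominatedBy (friendship n) (false ∷ s))) (cong₂ _∧_ centreDominated leavesDominated)
  where
  centreDominated : anyFin (λ u → lookup (false ∷ s) u ∧ friendAdj u fz) ≡ anyFin (lookup s)
  centreDominated = trans (anyFin-suc (λ u → lookup (false ∷ s) u ∧ friendAdj u fz))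
                          (anyFin-cong (∧-identityʳ ∘ lookup s))
  leafDominated : ∀ w → dominatedBy (friendship n) (false ∷ s) (fs w) ≡ dominatedInMatching s w
  leafDominated w = cong (lookup s w ∨_) (trans (anyFin-suc (λ u → lookup (false ∷ s) u ∧ friendAdj u (fs w)))
                                                (anyFin-cong (λ u → cong (lookup s u ∧_) (friendAdj-suc-suc u w))))
  leavesDominated : allFin? (dominatedBy (friendship n) (false ∷ s) ∘ fs) ≡ hitsEveryPair s
  leavesDominated = trans (allFin?-cong leafDominated) (allFin?-dominatedInMatching s)

sumMap : {A : Set} → (A → ℤ) → List A → ℤ
sumMap f xs = List.foldr _+_ 0ℤ (List.map f xs)

module _ {A : Set} where
  sumMap-++ : (f : A → ℤ) (xs ys : List A) → sumMap f (xs ++ ys) ≡ sumMap f xs + sumMap f ys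
  sumMap-++ f []       ys = sym (ℤ.+-identityˡ _)
  sumMap-++ f (x ∷ xs) ys = trans (cong (_+_ (f x)) (sumMap-++ f xs ys)) (sym (ℤ.+-assoc (f x) _ _))

  sumMap-map : {B : Set} (f : B → ℤ) (g : A → B) (xs : List A) → sumMap f (List.map g xs) ≡ sumMap (f ∘ g) xs
  sumMap-map f g xs = cong (List.foldr _+_ 0ℤ) (sym (List.map-∘ xs))

  sumMap-cong : {f g : A → ℤ} → (∀ a → f a ≡ g a) → (xs : List A) → sumMap f xs ≡ sumMap g xs
  sumMap-cong f≗g xs = cong (List.foldr _+_ 0ℤ) (List.map-cong f≗g xs)

  sumMap-*ˡ : (c : ℤ) (f : A → ℤ) (xs : List A) → sumMap (λ a → c * f a) xs ≡ c * sumMap f xs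
  sumMap-*ˡ c f []       = sym (ℤ.*-zeroʳ c)
  sumMap-*ˡ c f (x ∷ xs) = trans (cong (_+_ (c * f x)) (sumMap-*ˡ c f xs)) (sym (ℤ.*-distribˡ-+ c (f x) _))

sumSubsets : (m : ℕ) → (Subset m → ℤ) → ℤ
sumSubsets m f = sumMap f (allSubsets m)

sumSubsets-suc : ∀ m (f : Subset (suc m) → ℤ) →
  sumSubsets (suc m) f ≡ sumSubsets m (f ∘ (false ∷_)) + sumSubsets m (f ∘ (true ∷_))
sumSubsets-suc m f = trans (sumMap-++ f (List.map (false ∷_) (allSubsets m)) _)
  (cong₂ _+_ (sumMap-map f (false ∷_) (allSubsets m)) (sumMap-map f (true ∷_) (allSubsets m)))

sumSubsets-*ˡ : ∀ m c (g : Subset m → ℤ) {f} → (∀ s → f s ≡ c * g s) → sumSubsets m f ≡ c * sumSubsets m g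
sumSubsets-*ˡ m c g f≗cg = trans (sumMap-cong f≗cg (allSubsets m)) (sumMap-*ˡ c g (allSubsets m))

sumSubsets-^size : ∀ x m → sumSubsets m (λ s → x ^ size s) ≡ (1ℤ + x) ^ m
sumSubsets-^size x zero    = refl
sumSubsets-^size x (suc m) = begin
  sumSubsets (suc m) w                 ≡⟨ sumSubsets-suc m w ⟩
  W + sumSubsets m (λ s → x * w s)     ≡⟨ cong (_+_ W) (sumSubsets-*ˡ m x w (λ _ → refl)) ⟩
  W + x * W                            ≡⟨ cong (λ q → q + x * q) (sumSubsets-^size x m) ⟩
  (1ℤ + x) ^ m + x * (1ℤ + x) ^ m      ≡⟨ +-*-factor x ((1ℤ + x) ^ m) ⟩
  (1ℤ + x) ^ suc m                     ∎
  where
  open ≡-Reasoning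
  w : ∀ {k} → Subset k → ℤ
  w s = x ^ size s
  W : ℤ
  W = sumSubsets m w
  +-*-factor : ∀ x q → q + x * q ≡ (1ℤ + x) * q
  +-*-factor = solve-∀

if-*ˡ : ∀ b c y → (if b then c * y else 0ℤ) ≡ c * (if b then y else 0ℤ)
if-*ˡ true  c y = refl
if-*ˡ false c y = sym (ℤ.*-zeroʳ c)

pairCoverPoly : ℤ → ℕ → ℤ
pairCoverPoly x 0                   = 1ℤ
pairCoverPoly x 1                   = x
pairCoverPoly x (suc (suc m)) = (+ 2 * x + x * x) * pairCoverPoly x m

sumSubsets-hitsEveryPair : ∀ x m →
  sumSubsets m (λ s → if hitsEveryPair s then x ^ size s else 0ℤ) ≡ pairCoverPoly x m
sumSubsets-hitsEveryPair x 0             = refl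
sumSubsets-hitsEveryPair x 1             = trans (ℤ.+-identityˡ _) (trans (ℤ.+-identityʳ (x * 1ℤ)) (ℤ.*-identityʳ x))
sumSubsets-hitsEveryPair x (suc (suc m)) = begin
  sumSubsets (2 ℕ.+ m) w
    ≡⟨ trans (sumSubsets-suc (suc m) w)
             (cong₂ _+_ (sumSubsets-suc m (w ∘ (false ∷_))) (sumSubsets-suc m (w ∘ (true ∷_)))) ⟩
  (sumSubsets m (w ∘ (false ∷_) ∘ (false ∷_)) + sumSubsets m (w ∘ (false ∷_) ∘ (true ∷_)))
    + (sumSubsets m (w ∘ (true ∷_) ∘ (false ∷_)) + sumSubsets m (w ∘ (true ∷_) ∘ (true ∷_)))
    ≡⟨ cong₂ _+_ (cong₂ _+_ (sumSubsets-*ˡ m 0ℤ w (λ _ → refl)) (sumSubsets-*ˡ m x w x-weight))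
                 (cong₂ _+_ (sumSubsets-*ˡ m x w x-weight) (sumSubsets-*ˡ m (x * x) w x²-weight)) ⟩
  (0ℤ * W + x * W) + (x * W + x * x * W)
    ≡⟨ collect x W ⟩
  (+ 2 * x + x * x) * W
    ≡⟨ cong ((+ 2 * x + x * x) *_) (sumSubsets-hitsEveryPair x m) ⟩
  (+ 2 * x + x * x) * pairCoverPoly x m ∎
  where
  open ≡-Reasoning
  w : ∀ {k} → Subset k → ℤ
  w s = if hitsEveryPair s then x ^ size s else 0ℤ
  W : ℤ
  W = sumSubsets m w
  x-weight : ∀ s → w (false ∷ true ∷ s) ≡ x * w s
  x-weight s = if-*ˡ (hitsEveryPair s) x (x ^ size s)
  x²-weight : ∀ s → w (true ∷ true ∷ s) ≡ x * x * w s
  x²-weight s = trans (if-*ˡ (hitsEveryPair s) x _) (trans (cong (x *_) (x-weight s)) (sym (ℤ.*-assoc x x _)))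
  collect : ∀ x W → (0ℤ * W + x * W) + (x * W + x * x * W) ≡ (+ 2 * x + x * x) * W
  collect = solve-∀

pairCoverPoly-even : ∀ x n → pairCoverPoly x (2 ℕ.* n) ≡ (+ 2 * x + x * x) ^ n
pairCoverPoly-even x zero    = refl
pairCoverPoly-even x (suc n) =
  trans (cong (pairCoverPoly x) (ℕ.*-suc 2 n)) (cong ((+ 2 * x + x * x) *_) (pairCoverPoly-even x n))

dominationPoly-friendship : ∀ n x →
  dominationPoly (friendship (suc n)) x ≡ (+ 2 * x + x * x) ^ suc n + x * (1ℤ + x) ^ (2 ℕ.* suc n)
dominationPoly-friendship n x = begin
  dominationPoly (friendship (suc n)) x
    ≡⟨ sumSubsets-suc (2 ℕ.* suc n) w ⟩
  sumSubsets (2 ℕ.* suc n) (w ∘ (false ∷_)) + sumSubsets (2 ℕ.* suc n) (w ∘ (true ∷_))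
    ≡⟨ cong₂ _+_ (sumMap-cong withoutCentre (allSubsets (2 ℕ.* suc n)))
                 (sumSubsets-*ˡ (2 ℕ.* suc n) x (λ s → x ^ size s) withCentre) ⟩
  sumSubsets (2 ℕ.* suc n) (λ s → if hitsEveryPair s then x ^ size s else 0ℤ)
    + x * sumSubsets (2 ℕ.* suc n) (λ s → x ^ size s)
    ≡⟨ cong₂ (λ a b → a + x * b) (sumSubsets-hitsEveryPair x (2 ℕ.* suc n)) (sumSubsets-^size x (2 ℕ.* suc n)) ⟩
  pairCoverPoly x (2 ℕ.* suc n) + x * (1ℤ + x) ^ (2 ℕ.* suc n)
    ≡⟨ cong (_+ x * (1ℤ + x) ^ (2 ℕ.* suc n)) (pairCoverPoly-even x (suc n)) ⟩
  (+ 2 * x + x * x) ^ suc n + x * (1ℤ + x) ^ (2 ℕ.* suc n) ∎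
  where
  open ≡-Reasoning
  w : Subset (suc (2 ℕ.* suc n)) → ℤ
  w S = if isDominating (friendship (suc n)) S then x ^ size S else 0ℤ
  withoutCentre : ∀ s → w (false ∷ s) ≡ (if hitsEveryPair s then x ^ size s else 0ℤ)
  withoutCentre s = cong (λ b → if b then x ^ size s else 0ℤ)
    (trans (isDominating-friendship-noCentre (suc n) s) (hitsEveryPair⇒nonempty s))
  withCentre : ∀ s → w (true ∷ s) ≡ x * x ^ size s
  withCentre s = cong (λ b → if b then x * x ^ size s else 0ℤ) (isDominating-friendship-centre (suc n) s)

Even Odd : ℤ → Set
Even z = ∃[ k ] z ≡ k + k
Odd  z = ∃[ k ] z ≡ 1ℤ + (k + k)

even⊎odd : ∀ z → Even z ⊎ Odd z
even⊎odd z with z %ℕ 2 | n%ℕd<d z 2 | a≡a%ℕn+[a/ℕn]*n z 2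
... | 0 | _ | z≡q*2   = inj₁ (z /ℕ 2 , trans z≡q*2 (halve₀ (z /ℕ 2)))
  where
  halve₀ : ∀ q → + 0 + q * + 2 ≡ q + q
  halve₀ = solve-∀
... | 1 | _ | z≡1+q*2 = inj₂ (z /ℕ 2 , trans z≡1+q*2 (halve₁ (z /ℕ 2)))
  where
  halve₁ : ∀ q → 1ℤ + q * + 2 ≡ 1ℤ + (q + q)
  halve₁ = solve-∀
... | suc (suc _) | s≤s (s≤s ()) | _

even-2 : Even (+ 2)
even-2 = 1ℤ , refl

odd-1 : Odd 1ℤ
odd-1 = 0ℤ , refl

odd⇒≢0 : ∀ {z} → Odd z → z ≢ 0ℤ
odd⇒≢0 (+ k    , refl) ()
odd⇒≢0 (-[1+ k ] , refl) ()

module _ {a b : ℤ} where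
  even+even⇒even : Even a → Even b → Even (a + b)
  even+even⇒even (j , refl) (k , refl) = j + k , identity j k
    where
    identity : ∀ j k → (j + j) + (k + k) ≡ (j + k) + (j + k)
    identity = solve-∀

  even+odd⇒odd : Even a → Odd b → Odd (a + b)
  even+odd⇒odd (j , refl) (k , refl) = j + k , identity j k
    where
    identity : ∀ j k → (j + j) + (1ℤ + (k + k)) ≡ 1ℤ + ((j + k) + (j + k))
    identity = solve-∀

  odd+even⇒odd : Odd a → Even b → Odd (a + b)
  odd+even⇒odd (j , refl) (k , refl) = j + k , identity j k
    where
    identity : ∀ j k → (1ℤ + (j + j)) + (k + k) ≡ 1ℤ + ((j + k) + (j + k))
    identity = solve-∀

  odd+odd⇒even : Odd a → Odd b → Even (a + b)
  odd+odd⇒even (j , refl) (k , refl) = 1ℤ + j + k , identity j k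
    where
    identity : ∀ j k → (1ℤ + (j + j)) + (1ℤ + (k + k)) ≡ (1ℤ + j + k) + (1ℤ + j + k)
    identity = solve-∀

  odd*odd⇒odd : Odd a → Odd b → Odd (a * b)
  odd*odd⇒odd (j , refl) (k , refl) = j + k + (j + j) * k , identity j k
    where
    identity : ∀ j k → (1ℤ + (j + j)) * (1ℤ + (k + k)) ≡ 1ℤ + ((j + k + (j + j) * k) + (j + k + (j + j) * k))
    identity = solve-∀

even⇒even-* : ∀ {a} b → Even a → Even (a * b)
even⇒even-* b (j , refl) = j * b , identity j b
  where
  identity : ∀ j b → (j + j) * b ≡ j * b + j * b
  identity = solve-∀

odd⇒odd-^ : ∀ {a} n → Odd a → Odd (a ^ n)
odd⇒odd-^ zero    _     = 0ℤ , refl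
odd⇒odd-^ (suc n) odd-a = odd*odd⇒odd odd-a (odd⇒odd-^ n odd-a)

friendshipCofactor : ℕ → ℤ → ℤ
friendshipCofactor n x = (x + + 2) * (+ 2 * x + x * x) ^ n + (1ℤ + x) ^ (2 ℕ.* suc n)

dominationPoly-friendship-factor : ∀ n x → dominationPoly (friendship (suc n)) x ≡ x * friendshipCofactor n x
dominationPoly-friendship-factor n x =
  trans (dominationPoly-friendship n x) (factor x ((+ 2 * x + x * x) ^ n) ((1ℤ + x) ^ (2 ℕ.* suc n)))
  where
  factor : ∀ x p q → (+ 2 * x + x * x) * p + x * q ≡ x * ((x + + 2) * p + q)
  factor = solve-∀

friendshipCofactor-odd : ∀ n x → Odd (friendshipCofactor n x)
friendshipCofactor-odd n x with even⊎odd x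
... | inj₁ even-x = even+odd⇒odd (even⇒even-* _ (even+even⇒even even-x even-2))
                                  (odd⇒odd-^ (2 ℕ.* suc n) (odd+even⇒odd odd-1 even-x))
-- 2 * suc n reduces to a successor, so (1 + x) ^ (2 * suc n) is (1 + x) times a power.
... | inj₂ odd-x  = odd+even⇒odd (odd*odd⇒odd (odd+even⇒odd odd-x even-2) (odd⇒odd-^ n odd-2x+x²))
                                  (even⇒even-* _ (odd+odd⇒even odd-1 odd-x))
  where
  odd-2x+x² : Odd (+ 2 * x + x * x)
  odd-2x+x² = even+odd⇒odd (even⇒even-* x even-2) (odd*odd⇒odd odd-x odd-x)

mainTheorem7 : (n : ℕ) → n ≥ 1 → (x : ℤ) → ¬ (x ≡ 0ℤ) → ¬ (dominationPoly (friendship n) x ≡ 0ℤ)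
mainTheorem7 (suc n) _ x x≢0 D≡0 =
  [ x≢0 , odd⇒≢0 (friendshipCofactor-odd n x) ]′
    (ℤ.i*j≡0⇒i≡0∨j≡0 x (trans (sym (dominationPoly-friendship-factor n x)) D≡0))
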